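{- If $G$ is a graph on $n$ vertices, then $\Gamma_{\rho}(G)\le n-i(G)+1$.
   Context: Graphs are finite and simple; $d(u,v)$ is the distance in $G$. A packing coloring $c:V(G)\to\{1,\dots,k\}$ satisfies: $c(u)=c(v)=i$, $u\ne v$, implies $d(u,v)>i$. The Grundy packing chromatic number $\Gamma_{\rho}(G)$ is the maximum number of colors $k$ in a packing coloring $c:V(G)\to\{1,\dots,k\}$ using all $k$ colors in which every vertex $v$ with $c(v)=i$ has, for every $j\in\{1,\dots,i-1\}$, a vertex $u$ with $c(u)=j$ and $d(u,v)\le j$ (equivalently, the maximum number of colors produced by the greedy procedure that processes vertices in some order and assigns each vertex the smallest color $i$ with no already-colored vertex of color $i$ at distance at most $i$). $i(G)$ is the independent domination number: the minimum cardinality of a maximal independent set of $G$. -}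

module Defs where

open import Data.Nat using (ℕ; zero; suc; _≤_; _<_)
open import Data.Fin using (Fin)
open import Data.Fin.Subset using (Subset; _∈_; _⊆_; ∣_∣)
open import Data.Product using (Σ; _×_; ∃)
open import Relation.Binary.PropositionalEquality using (_≡_; _≢_)
open import Relation.Nullary using (¬_)

record Graph (n : ℕ) : Set₁ where
  field
    Adj       : Fin n → Fin n → Set
    irrefl    : ∀ v → ¬ Adj v v
    sym       : ∀ {u v} → Adj u v → Adj v u
open Graph public

data Walk {n : ℕ} (G : Graph n) : Fin n → Fin n → ℕ → Set where
  here : ∀ {u} → Walk G u u 0
  step : ∀ {u w v m} → Adj G u w → Walk G w v m → Walk G u v (suc m)

-- d(u,v) ≤ j  (distance is infinite between different components)
DistLe : ∀ {n} → Graph n → Fin n → Fin n → ℕ → Set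
DistLe G u v j = Σ ℕ λ m → m ≤ j × Walk G u v m

IsPackingColoring : ∀ {n} → Graph n → (Fin n → ℕ) → ℕ → Set
IsPackingColoring G c k =
  (∀ v → 1 ≤ c v × c v ≤ k) ×
  (∀ i → 1 ≤ i → i ≤ k → ∃ λ v → c v ≡ i) ×
  (∀ u v → u ≢ v → c u ≡ c v → ¬ DistLe G u v (c u))

IsGrundyPackingColoring : ∀ {n} → Graph n → (Fin n → ℕ) → ℕ → Set
IsGrundyPackingColoring G c k =
  IsPackingColoring G c k ×
  (∀ v j → 1 ≤ j → j < c v → ∃ λ u → c u ≡ j × DistLe G u v j)

IsGrundyPackingChromaticNumber : ∀ {n} → Graph n → ℕ → Set
IsGrundyPackingChromaticNumber G γ =
  (Σ _ λ c → IsGrundyPackingColoring G c γ) ×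
  (∀ k c → IsGrundyPackingColoring G c k → k ≤ γ)

IsIndependent : ∀ {n} → Graph n → Subset n → Set
IsIndependent G S = ∀ u v → u ∈ S → v ∈ S → ¬ Adj G u v

IsMaximalIndependent : ∀ {n} → Graph n → Subset n → Set
IsMaximalIndependent G S =
  IsIndependent G S × (∀ T → IsIndependent G T → S ⊆ T → T ⊆ S)

IsIndependentDominationNumber : ∀ {n} → Graph n → ℕ → Set
IsIndependentDominationNumber G m =
  (Σ _ λ S → IsMaximalIndependent G S × ∣ S ∣ ≡ m) ×
  (∀ S → IsMaximalIndependent G S → m ≤ ∣ S ∣)

-- The vertices of colour 1 in a Grundy packing colouring form an independent set (two of them
-- would be at distance 1) which dominates the graph (every other vertex needs a colour-1
-- vertex at distance at most 1), hence a maximal independent set; so at least i(G) vertices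
-- have colour 1. Each of the remaining colours 2, …, Γ_ρ(G) is used by a different vertex
-- among the other at most n − i(G) vertices.
module Submission where

open import Defs hiding (sym)
open import Data.Nat using (ℕ; zero; suc; _≤_; _<_; _∸_; _+_; _≟_; _<?_; z≤n; s≤s)
open import Data.Nat.Properties
  using (≤-refl; ≤-trans; m≤m+n; m≤n⇒m≤1+n; +-suc; +-comm; +-monoʳ-≤; ∸-monoʳ-≤;
         ≤∧≢⇒<; ≮⇒≥; <⇒≢; <⇒≤; module ≤-Reasoning)
open import Data.Fin using (Fin) renaming (_≟_ to _≟ᶠ_)
open import Data.Fin.Subset using (Subset; _∈_; _∉_; _⊆_; ∁; _-_; ∣_∣)
open import Data.Fin.Subset.Properties
  using (_∈?_; ∣∁p∣≡n∸∣p∣; x∉p⇒x∈∁p; x∈p∧x≢y⇒x∈p-y; x∈p⇒∣p-x∣<∣p∣)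
open import Data.Vec using (tabulate)
open import Data.Vec.Properties using (lookup∘tabulate; []=⇒lookup; lookup⇒[]=)
open import Data.Product using (∃; _×_; _,_; proj₁)
open import Data.Sum using (_⊎_; inj₁; inj₂)
open import Function using (_∘_)
open import Relation.Nullary using (yes; no; contradiction)
open import Relation.Nullary.Decidable using (does; dec-true; dec-false; decidable-stable)
open import Relation.Binary.PropositionalEquality using (_≡_; _≢_; refl; sym; trans; cong; subst)

private
  variable
    n : ℕ
    G : Graph n

adj⇒distLe1 : ∀ {u v} → Adj G u v → DistLe G u v 1
adj⇒distLe1 uv = 1 , ≤-refl , step uv here

distLe1⇒≡⊎adj : ∀ {u v} → DistLe G u v 1 → u ≡ v ⊎ Adj G u v
distLe1⇒≡⊎adj (0 , _ , here)             = inj₁ refl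
distLe1⇒≡⊎adj (1 , _ , step uv here)     = inj₂ uv
distLe1⇒≡⊎adj (suc (suc _) , s≤s () , _)

IsDominating : Graph n → Subset n → Set
IsDominating G S = ∀ v → v ∉ S → ∃ λ u → u ∈ S × Adj G u v

independent∧dominating⇒maximal : ∀ {S} → IsIndependent G S → IsDominating G S →
                                 IsMaximalIndependent G S
independent∧dominating⇒maximal {G = G} {S} indS domS = indS , maximal
  where
  maximal : ∀ T → IsIndependent G T → S ⊆ T → T ⊆ S
  maximal T indT S⊆T {v} v∈T = decidable-stable (v ∈? S) λ v∉S →
    let (u , u∈S , uv) = domS v v∉S in indT u v (S⊆T u∈S) v∈T uv

AttainsAll : (Fin n → ℕ) → Subset n → ℕ → ℕ → Set
AttainsAll c p a b = ∀ i → a < i → i ≤ b → ∃ λ v → v ∈ p × c v ≡ i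

module _ {c : Fin n → ℕ} {a : ℕ} where

  attainsAll-remove : ∀ {p b v} → AttainsAll c p a (suc b) → c v ≡ suc b →
                      AttainsAll c (p - v) a b
  attainsAll-remove {v = v} attains cv≡1+b i a<i i≤b
    with attains i a<i (m≤n⇒m≤1+n i≤b)
  ... | w , w∈p , cw≡i = w , x∈p∧x≢y⇒x∈p-y w∈p w≢v , cw≡i
    where
    w≢v : w ≢ v
    w≢v refl = <⇒≢ (s≤s i≤b) (trans (sym cw≡i) cv≡1+b)

  attainsAll⇒≤+∣p∣ : ∀ {p} b → AttainsAll c p a b → b ≤ a + ∣ p ∣
  attainsAll⇒≤+∣p∣ zero _ = z≤n
  attainsAll⇒≤+∣p∣ {p} (suc b) attains with a <? suc b
  ... | no a≮1+b = ≤-trans (≮⇒≥ a≮1+b) (m≤m+n a ∣ p ∣)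
  ... | yes a<1+b with attains (suc b) a<1+b ≤-refl
  ...   | v , v∈p , cv≡1+b = begin
    suc b               ≤⟨ s≤s (attainsAll⇒≤+∣p∣ b (attainsAll-remove attains cv≡1+b)) ⟩
    suc (a + ∣ p - v ∣) ≡⟨ +-suc a _ ⟨
    a + suc ∣ p - v ∣   ≤⟨ +-monoʳ-≤ a (x∈p⇒∣p-x∣<∣p∣ v∈p) ⟩
    a + ∣ p ∣           ∎
    where open ≤-Reasoning

colourClass : (Fin n → ℕ) → ℕ → Subset n
colourClass c i = tabulate λ v → does (c v ≟ i)

module _ (c : Fin n → ℕ) {i : ℕ} {v : Fin n} where

  ∈colourClass⁺ : c v ≡ i → v ∈ colourClass c i
  ∈colourClass⁺ cv≡i =
    lookup⇒[]= v _ (trans (lookup∘tabulate _ v) (dec-true (c v ≟ i) cv≡i))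

  ∈colourClass⁻ : v ∈ colourClass c i → c v ≡ i
  ∈colourClass⁻ v∈ = decidable-stable (c v ≟ i) λ cv≢i → contradiction
    (trans (sym ([]=⇒lookup v∈)) (trans (lookup∘tabulate _ v) (dec-false (c v ≟ i) cv≢i)))
    λ ()

module _ {c : Fin n → ℕ} {k : ℕ} where

  colourClass1-independent : IsPackingColoring G c k → IsIndependent G (colourClass c 1)
  colourClass1-independent {G = G} (_ , _ , packed) u v u∈ v∈ uv with u ≟ᶠ v
  ... | yes refl = irrefl G u uv
  ... | no u≢v   = packed u v u≢v (trans cu≡1 (sym (∈colourClass⁻ c v∈)))
                          (subst (DistLe G u v) (sym cu≡1) (adj⇒distLe1 uv))
    where
    cu≡1 : c u ≡ 1
    cu≡1 = ∈colourClass⁻ c u∈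

  colourClass1-dominating : IsGrundyPackingColoring G c k → IsDominating G (colourClass c 1)
  colourClass1-dominating ((inRange , _) , grundy) v v∉
    with grundy v 1 ≤-refl (≤∧≢⇒< (proj₁ (inRange v)) (v∉ ∘ ∈colourClass⁺ c ∘ sym))
  ... | u , cu≡1 , d with distLe1⇒≡⊎adj d
  ...   | inj₁ refl = contradiction (∈colourClass⁺ c cu≡1) v∉
  ...   | inj₂ uv   = u , ∈colourClass⁺ c cu≡1 , uv

  colourClass1-maximalIndependent : IsGrundyPackingColoring G c k →
                                    IsMaximalIndependent G (colourClass c 1)
  colourClass1-maximalIndependent {G = G} grundy =
    independent∧dominating⇒maximal {G = G} (colourClass1-independent (proj₁ grundy))
                                           (colourClass1-dominating grundy)

  colours>1-outsideColourClass1 : IsPackingColoring G c k →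
                                  AttainsAll c (∁ (colourClass c 1)) 1 k
  colours>1-outsideColourClass1 (_ , onto , _) i 1<i i≤k with onto i (<⇒≤ 1<i) i≤k
  ... | v , cv≡i = v , x∉p⇒x∈∁p (λ v∈ → <⇒≢ 1<i (trans (sym (∈colourClass⁻ c v∈)) cv≡i)) , cv≡i

corollary5 : (n : ℕ) (G : Graph n) (γ m : ℕ) →
    IsGrundyPackingChromaticNumber G γ →
    IsIndependentDominationNumber G m →
    γ ≤ n ∸ m + 1
corollary5 n G γ m ((c , grundy) , _) (_ , minimum) = begin
  γ               ≤⟨ attainsAll⇒≤+∣p∣ γ (colours>1-outsideColourClass1 {c = c} (proj₁ grundy)) ⟩
  1 + ∣ ∁ S ∣     ≡⟨ cong (1 +_) (∣∁p∣≡n∸∣p∣ S) ⟩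
  1 + (n ∸ ∣ S ∣) ≤⟨ +-monoʳ-≤ 1 (∸-monoʳ-≤ n m≤∣S∣) ⟩
  1 + (n ∸ m)     ≡⟨ +-comm 1 (n ∸ m) ⟩
  n ∸ m + 1       ∎
  where
  open ≤-Reasoning
  S : Subset n
  S = colourClass c 1
  m≤∣S∣ : m ≤ ∣ S ∣
  m≤∣S∣ = minimum S (colourClass1-maximalIndependent {c = c} grundy)
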